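{- Let $G$ be a graph, and let $G'$ be a graph obtained from $G$ by smoothing a $2$-valent vertex. Then $\mathrm{scw}(G')\leq\mathrm{scw}(G)$.
   Context: All graphs are finite connected multigraphs (multiple edges allowed, no loops). If $u$ is a vertex of valence $2$ with distinct neighbors $v$ and $w$, smoothing at $u$ deletes $u$ (and its two edges) and adds an edge joining $v$ and $w$. Screewidth: a tree-cut decomposition of $G$ is a pair $(T,\mathcal{X})$ with $T$ a tree (vertices = nodes, edges = links) and $\mathcal{X}=\{X_b: b\in V(T)\}$ pairwise disjoint, possibly empty subsets of $V(G)$ (bags) with union $V(G)$. For a link $l$, $\mathrm{adh}(l)$ is the set of edges of $G$ with endpoints in bags $X_b,X_d$ where $b,d$ lie in different components of $T-l$; for a node $b$, $\mathrm{adh}(b)$ is the set of edges of $G$ with endpoints in bags $X_c,X_d$ where $c,d$ lie in different components of $T-b$. The width is $\max\{\max_l|\mathrm{adh}(l)|,\ \max_b(|X_b|+|\mathrm{adh}(b)|)\}$, and $\mathrm{scw}(G)$ is the minimum width over all tree-cut decompositions of $G$. -}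

module Defs where

open import Data.Nat using (ℕ; zero; suc; _+_; _⊔_; _≤_)
open import Data.Bool using (Bool; true; false; _∧_; _∨_; not; if_then_else_)
open import Data.Fin using (Fin; _≟_; punchOut)
open import Data.List using (List; []; _∷_; length; map; foldr; removeAt; mapMaybe; allFin; filterᵇ)
open import Data.Bool.ListAction using (any)
open import Data.List.Relation.Unary.All using (All)
open import Data.Maybe using (Maybe; just; nothing)
open import Data.Product using (_×_; _,_; Σ; proj₁; proj₂)
open import Relation.Nullary using (does; ¬_)
open import Relation.Binary.PropositionalEquality using (_≡_; _≢_)

_==_ : ∀ {n} → Fin n → Fin n → Bool
a == b = does (a ≟ b)

-- A finite multigraph on vertex set Fin n is given by its list of edges;
-- an edge is an (ordered, but read as unordered) pair of endpoints.
Edges : ℕ → Set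
Edges n = List (Fin n × Fin n)

countB : ∀ {A : Set} → (A → Bool) → List A → ℕ
countB f [] = 0
countB f (x ∷ xs) = if f x then suc (countB f xs) else countB f xs

maxL : List ℕ → ℕ
maxL = foldr _⊔_ 0

-- conn ok L s a b : there is a walk of length ≤ s from a to b using only
-- edges of L and only vertices c with ok c ≡ true.
conn : ∀ {k} → (Fin k → Bool) → Edges k → ℕ → Fin k → Fin k → Bool
conn ok L zero a b = ok a ∧ (a == b)
conn ok L (suc s) a b = conn ok L s a b ∨ any step L
  where
  step : _ → Bool
  step (x , y) = (conn ok L s a x ∧ ok y ∧ (y == b)) ∨ (conn ok L s a y ∧ ok x ∧ (x == b))

-- a and b lie in the same component of the graph (Fin k, L) restricted to
-- the vertices satisfying ok  (walks of length ≤ k suffice).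
sameComp : ∀ {k} → (Fin k → Bool) → Edges k → Fin k → Fin k → Bool
sameComp {k} ok L = conn ok L k

allV : ∀ {k} → Fin k → Bool
allV _ = true

Connected : ∀ {k} → Edges k → Set
Connected {k} L = ∀ a b → sameComp allV L a b ≡ true

Loopless : ∀ {k} → Edges k → Set
Loopless L = All (λ e → proj₁ e ≢ proj₂ e) L

-- finite connected loopless multigraph on Fin n (n ≥ 1 is enforced by
-- using Fin (suc n) in the statement)
IsGraph : ∀ {n} → Edges n → Set
IsGraph E = Loopless E × Connected E

IsTree : (k : ℕ) → Edges k → Set
IsTree k L = (1 ≤ k) × (length L + 1 ≡ k) × Connected L

-- Tree-cut decomposition of a graph on Fin n.  The bags X_b are the fibres
-- of bag : Fin n → Fin k (pairwise disjoint, possibly empty, union V(G)).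
record TCD (n : ℕ) : Set where
  field
    k      : ℕ
    links  : Edges k
    isTree : IsTree k links
    bag    : Fin n → Fin k

module _ {n : ℕ} (E : Edges n) (D : TCD n) where
  open TCD D

  adhLink : Fin (length links) → ℕ
  adhLink l = countB (λ { (x , y) → not (sameComp allV (removeAt links l) (bag x) (bag y)) }) E

  -- |adh(b)| : edges whose end-bags lie in different components of T - b
  adhNode : Fin k → ℕ
  adhNode b = countB (λ { (x , y) → not (bag x == b) ∧ not (bag y == b)
                          ∧ not (sameComp (λ c → not (c == b)) links (bag x) (bag y)) }) E

  bagSize : Fin k → ℕ
  bagSize b = countB (λ v → bag v == b) (allFin n)

  width : ℕ
  width = maxL (map adhLink (allFin (length links)))
          ⊔ maxL (map (λ b → bagSize b + adhNode b) (allFin k))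

IsScw : ∀ {n} → Edges n → ℕ → Set
IsScw {n} E s = Σ (TCD n) (λ D → width E D ≡ s) × (∀ (D : TCD n) → s ≤ width E D)

incident : ∀ {n} → Fin n → Fin n × Fin n → Bool
incident u (a , b) = (a == u) ∨ (b == u)

incEdges : ∀ {n} → Fin n → Edges n → Edges n
incEdges u E = filterᵇ (incident u) E

other : ∀ {n} → Fin n → Fin n × Fin n → Fin n
other u (a , b) = if a == u then b else a

lower : ∀ {n} → Fin (suc n) → Fin (suc n) → Maybe (Fin n)
lower u x with u ≟ x
... | Relation.Nullary.yes _ = nothing
... | Relation.Nullary.no p  = just (punchOut p)

lowerEdge : ∀ {n} → Fin (suc n) → Fin (suc n) × Fin (suc n) → Maybe (Fin n × Fin n)
lowerEdge u (a , b) with lower u a | lower u b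
... | just a' | just b' = just (a' , b')
... | _       | _       = nothing

-- smoothing at u whose two edges go to v and w: delete u and its edges,
-- add an edge v w.
smooth : ∀ {n} (E : Edges (suc n)) (u v w : Fin (suc n)) → u ≢ v → u ≢ w → Edges n
smooth E u v w uv uw = (punchOut uv , punchOut uw) ∷ mapMaybe (lowerEdge u) E

{-# OPTIONS --safe #-}
-- Take an optimal tree-cut decomposition of G and remove u from its bag, keeping the tree.
-- Lying in a common component of T − l (or of T − b) is an equivalence relation, so the new
-- edge vw crosses a link or a node only if uv or uw does.  Hence no adhesion grows, except at
-- the node whose bag held u, where the single possible new crossing edge is paid for by u
-- leaving that bag.
module Submission where

open import Defs
open import Data.Bool using (Bool; true; false; T; not; _∧_; _∨_)
open import Data.Bool.Properties using (T-∧; T-∨; ∨-zeroʳ; not-involutive)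
open import Data.Empty using (⊥-elim)
open import Data.Fin using (Fin; zero; suc; _≟_; punchIn; punchOut)
open import Data.Fin.Properties using (any?; punchIn-punchOut; punchInᵢ≢i)
open import Data.List using ([]; _∷_; length; map; allFin; tabulate; mapMaybe; removeAt)
open import Data.List.Membership.Propositional using (_∈_; find; lose)
open import Data.List.Membership.Propositional.Properties using (∈-allFin; ∈-map⁻; ∈-filter⁻)
open import Data.List.Properties using (length-tabulate)
open import Data.List.Relation.Unary.Any using (Any; here; there)
open import Data.List.Relation.Unary.Any.Properties using (any⁺; any⁻)
open import Data.Maybe using (just; nothing)
open import Data.Nat using (ℕ; zero; suc; _+_; _≤_; _<_; _≤′_; ≤′-reflexive; ≤′-step; z≤n; s≤s)
open import Data.Nat.Properties
  using (<-≤-trans; n<1+n; m<n⇒m<1+n; m≤n⇒m≤1+n; ≤⇒≤′; <⇒≱; +-suc; +-identityʳ;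
         +-assoc; +-comm; +-monoˡ-≤; +-monoʳ-≤; ⊔-mono-≤; +-commutativeSemigroup; module ≤-Reasoning)
open import Algebra.Properties.CommutativeSemigroup +-commutativeSemigroup using (x∙yz≈y∙xz)
open import Data.Product using (_×_; _,_; ∃-syntax; proj₂; uncurry)
open import Data.Sum using (_⊎_; inj₁; inj₂; [_,_]; map₂; swap)
open import Data.Unit using (tt)
open import Function using (_∘_; _on_; id; Equivalence)
open import Relation.Binary.Definitions using (Symmetric)
open import Relation.Binary.PropositionalEquality using (_≡_; _≢_; refl; sym; trans; cong; cong₂; subst; module ≡-Reasoning)
open import Relation.Nullary using (yes; no; ¬_; ¬?; _×-dec_)
open import Relation.Nullary.Decidable using (T?; decidable-stable; dec-true; dec-false)

open Equivalence using (to; from)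

==-refl : ∀ {n} (a : Fin n) → T (a == a)
==-refl a with a ≟ a
... | yes _ = tt
... | no a≢a = a≢a refl

==⇒≡ : ∀ {n} {a b : Fin n} → T (a == b) → a ≡ b
==⇒≡ {a = a} {b} _ with a ≟ b
==⇒≡ _ | yes a≡b = a≡b
==⇒≡ () | no _

¬T⇒T-not : ∀ {b} → ¬ T b → T (not b)
¬T⇒T-not {false} _ = tt
¬T⇒T-not {true} ¬b = ¬b tt

T-not⇒¬T : ∀ {b} → T (not b) → ¬ T b
T-not⇒¬T {true} ()

indicator : Bool → ℕ
indicator true = 1
indicator false = 0

module _ {A : Set} where

  countB-∷ : ∀ (f : A → Bool) x xs → countB f (x ∷ xs) ≡ indicator (f x) + countB f xs
  countB-∷ f x xs with f x
  ... | true = refl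
  ... | false = refl

  countB-mono : ∀ {f g : A → Bool} → (∀ x → T (f x) → T (g x)) → ∀ xs → countB f xs ≤ countB g xs
  countB-mono f⇒g [] = z≤n
  countB-mono {f} {g} f⇒g (x ∷ xs) with f x | g x | f⇒g x
  ... | true  | true  | _ = s≤s (countB-mono f⇒g xs)
  ... | false | true  | _ = m≤n⇒m≤1+n (countB-mono f⇒g xs)
  ... | false | false | _ = countB-mono f⇒g xs
  ... | true  | false | fx⇒gx = ⊥-elim (fx⇒gx tt)

  countB-mono-< : ∀ {f g : A → Bool} → (∀ x → T (f x) → T (g x)) →
                  ∀ {y xs} → y ∈ xs → ¬ T (f y) → T (g y) → countB f xs < countB g xs
  countB-mono-< {f} {g} f⇒g {xs = x ∷ xs} (here refl) ¬fx gx with f x | g x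
  ... | true  | _    = ⊥-elim (¬fx tt)
  ... | false | true = s≤s (countB-mono f⇒g xs)
  countB-mono-< {f} {g} f⇒g {xs = x ∷ xs} (there y∈xs) ¬fy gy with f x | g x | f⇒g x
  ... | true  | true  | _ = s≤s (countB-mono-< f⇒g y∈xs ¬fy gy)
  ... | false | true  | _ = m≤n⇒m≤1+n (countB-mono-< f⇒g y∈xs ¬fy gy)
  ... | false | false | _ = countB-mono-< f⇒g y∈xs ¬fy gy
  ... | true  | false | fx⇒gx = ⊥-elim (fx⇒gx tt)

  countB≤length : ∀ (f : A → Bool) xs → countB f xs ≤ length xs
  countB≤length f [] = z≤n
  countB≤length f (x ∷ xs) with f x
  ... | true = s≤s (countB≤length f xs)
  ... | false = m≤n⇒m≤1+n (countB≤length f xs)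

  Any⇒countB-positive : ∀ {f : A → Bool} {xs} → Any (T ∘ f) xs → 1 ≤ countB f xs
  Any⇒countB-positive {f} {x ∷ xs} (here fx) with f x
  ... | true = s≤s z≤n
  Any⇒countB-positive {f} {x ∷ xs} (there any) with f x
  ... | true = s≤s z≤n
  ... | false = Any⇒countB-positive any

  indicator≤countB : ∀ {f : A → Bool} {b c xs} → (T b → T c ⊎ Any (T ∘ f) xs) →
                     indicator b ≤ indicator c + countB f xs
  indicator≤countB {b = false} _ = z≤n
  indicator≤countB {b = true} {c} b⇒ with c | b⇒ tt
  ... | true  | _        = s≤s z≤n
  ... | false | inj₂ any = Any⇒countB-positive any

countB-tabulate : ∀ {A : Set} {n} (f : A → Bool) (g : Fin n → A) →
                  countB f (tabulate g) ≡ countB (f ∘ g) (allFin n)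
countB-tabulate {n = zero} f g = refl
countB-tabulate {n = suc n} f g = begin
  countB f (tabulate g)                                     ≡⟨ countB-∷ f (g zero) (tabulate (g ∘ suc)) ⟩
  indicator (f (g zero)) + countB f (tabulate (g ∘ suc))    ≡⟨ cong (indicator (f (g zero)) +_) (countB-tabulate f (g ∘ suc)) ⟩
  indicator (f (g zero)) + countB (f ∘ g ∘ suc) (allFin n)  ≡⟨ cong (indicator (f (g zero)) +_) (countB-tabulate (f ∘ g) suc) ⟨
  indicator (f (g zero)) + countB (f ∘ g) (tabulate suc)    ≡⟨ countB-∷ (f ∘ g) zero (tabulate suc) ⟨
  countB (f ∘ g) (allFin (suc n))                           ∎
  where open ≡-Reasoning

countB-tabulate-punchIn : ∀ {A : Set} {n} (f : A → Bool) (g : Fin (suc n) → A) (u : Fin (suc n)) →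
                          countB f (tabulate g) ≡ indicator (f (g u)) + countB f (tabulate (g ∘ punchIn u))
countB-tabulate-punchIn f g zero = countB-∷ f (g zero) (tabulate (g ∘ suc))
countB-tabulate-punchIn {n = suc n} f g (suc u) = begin
  countB f (tabulate g)                               ≡⟨ countB-∷ f (g zero) (tabulate (g ∘ suc)) ⟩
  a + countB f (tabulate (g ∘ suc))                   ≡⟨ cong (a +_) (countB-tabulate-punchIn f (g ∘ suc) u) ⟩
  a + (b + countB f (tabulate (g ∘ suc ∘ punchIn u))) ≡⟨ x∙yz≈y∙xz a b _ ⟩
  b + (a + countB f (tabulate (g ∘ suc ∘ punchIn u))) ≡⟨ cong (b +_) (countB-∷ f (g zero) (tabulate (g ∘ suc ∘ punchIn u))) ⟨
  b + countB f (tabulate (g ∘ punchIn (suc u)))       ∎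
  where
  open ≡-Reasoning
  a = indicator (f (g zero))
  b = indicator (f (g (suc u)))

countB-allFin-punchIn : ∀ {n} (f : Fin (suc n) → Bool) (u : Fin (suc n)) →
                        countB f (allFin (suc n)) ≡ indicator (f u) + countB (f ∘ punchIn u) (allFin n)
countB-allFin-punchIn f u =
  trans (countB-tabulate-punchIn f id u) (cong (indicator (f u) +_) (countB-tabulate f (punchIn u)))

module Reachability {k : ℕ} (ok : Fin k → Bool) (L : Edges k) where

  record Reach (s : ℕ) (a b : Fin k) : Set where
    constructor reach
    field reached : T (conn ok L s a b)

  Adjacent : Fin k → Fin k → Set
  Adjacent x y = (x , y) ∈ L ⊎ (y , x) ∈ L

  reach-refl : ∀ {a} → T (ok a) → Reach 0 a a
  reach-refl {a} oka = reach (from T-∧ (oka , ==-refl a))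

  reach-zero⁻ : ∀ {a b} → Reach 0 a b → T (ok a) × a ≡ b
  reach-zero⁻ (reach r) with to T-∧ r
  ... | oka , a==b = oka , ==⇒≡ a==b

  reach-suc : ∀ {s a b} → Reach s a b → Reach (suc s) a b
  reach-suc (reach r) = reach (from T-∨ (inj₁ r))

  private
    arrival : ∀ {s a x y} → Reach s a x → T (ok y) → T (conn ok L s a x ∧ ok y ∧ (y == y))
    arrival {y = y} (reach r) oky = from T-∧ (r , from T-∧ (oky , ==-refl y))

  reach-step : ∀ {s a x y} → Reach s a x → Adjacent x y → T (ok y) → Reach (suc s) a y
  reach-step r (inj₁ xy∈L) oky = reach (from T-∨ (inj₂ (any⁺ _ (lose xy∈L (from T-∨ (inj₁ (arrival r oky)))))))
  reach-step r (inj₂ yx∈L) oky = reach (from T-∨ (inj₂ (any⁺ _ (lose yx∈L (from T-∨ (inj₂ (arrival r oky)))))))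

  private
    last-step : ∀ s {a b x y} → Adjacent x y → T (conn ok L s a x ∧ ok y ∧ (y == b)) →
                ∃[ x ] Reach s a x × Adjacent x b × T (ok b)
    last-step s {b = b} {y = y} adj t with to T-∧ t
    ... | r , t′ with to T-∧ t′
    ... | oky , y==b with ==⇒≡ {a = y} {b} y==b
    ... | refl = _ , reach r , adj , oky

  reach-suc⁻ : ∀ s {a b} → Reach (suc s) a b →
               Reach s a b ⊎ ∃[ x ] Reach s a x × Adjacent x b × T (ok b)
  reach-suc⁻ s (reach r) with to T-∨ r
  ... | inj₁ r′ = inj₁ (reach r′)
  ... | inj₂ r′ with find (any⁻ _ L r′)
  ... | (x , y) , xy∈L , t with to T-∨ t
  ... | inj₁ t′ = inj₂ (last-step s (inj₁ xy∈L) t′)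
  ... | inj₂ t′ = inj₂ (last-step s (inj₂ xy∈L) t′)

  reach-target-ok : ∀ s {a b} → Reach s a b → T (ok b)
  reach-target-ok zero r with reach-zero⁻ r
  ... | oka , refl = oka
  reach-target-ok (suc s) r with reach-suc⁻ s r
  ... | inj₁ r′ = reach-target-ok s r′
  ... | inj₂ (_ , _ , _ , okb) = okb

  reach-mono : ∀ {s t a b} → s ≤′ t → Reach s a b → Reach t a b
  reach-mono (≤′-reflexive refl) r = r
  reach-mono (≤′-step s≤′t) r = reach-suc (reach-mono s≤′t r)

  reach-trans : ∀ s t {a x b} → Reach s a x → Reach t x b → Reach (s + t) a b
  reach-trans s zero r r′ with reach-zero⁻ r′
  ... | _ , refl = subst (λ m → Reach m _ _) (sym (+-identityʳ s)) r
  reach-trans s (suc t) r r′ rewrite +-suc s t with reach-suc⁻ t r′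
  ... | inj₁ r″ = reach-suc (reach-trans s t r r″)
  ... | inj₂ (_ , r″ , adj , okb) = reach-step (reach-trans s t r r″) adj okb

  reach-sym : ∀ s {a b} → Reach s a b → Reach s b a
  reach-sym zero r with reach-zero⁻ r
  ... | _ , refl = r
  reach-sym (suc s) r with reach-suc⁻ s r
  ... | inj₁ r′ = reach-suc (reach-sym s r′)
  ... | inj₂ (x , r′ , adj , okb) =
    reach-trans 1 s (reach-step (reach-refl okb) (swap adj) (reach-target-ok s r′)) (reach-sym s r′)

  -- sameComp only follows walks of length ≤ k, so transitivity needs walks to be shortened:
  -- the set reached within s steps grows strictly until it stabilises, and has at most k elements.
  module _ (a : Fin k) where

    StableAt : ℕ → Set
    StableAt j = ∀ {x} → Reach (suc j) a x → Reach j a x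

    stable-absorbs : ∀ {j} → StableAt j → ∀ t {x} → Reach t a x → Reach j a x
    stable-absorbs st zero r = reach-mono (≤⇒≤′ z≤n) r
    stable-absorbs st (suc t) r with reach-suc⁻ t r
    ... | inj₁ r′ = stable-absorbs st t r′
    ... | inj₂ (_ , r′ , adj , okx) = st (reach-step (stable-absorbs st t r′) adj okx)

    reachCount : ℕ → ℕ
    reachCount s = countB (conn ok L s a) (allFin k)

    stabilises-or-grows : ∀ s → (∃[ j ] j < s × StableAt j) ⊎ s ≤ reachCount s
    stabilises-or-grows zero = inj₂ z≤n
    stabilises-or-grows (suc s) with stabilises-or-grows s
    ... | inj₁ (j , j<s , st) = inj₁ (j , m<n⇒m<1+n j<s , st)
    ... | inj₂ s≤count with any? (λ x → T? (conn ok L (suc s) a x) ×-dec ¬? (T? (conn ok L s a x)))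
    ... | yes (x , new , ¬old) = inj₂ (<-≤-trans (s≤s s≤count) (countB-mono-< grows (∈-allFin x) ¬old new))
      where
      grows : ∀ y → T (conn ok L s a y) → T (conn ok L (suc s) a y)
      grows y old = Reach.reached (reach-suc (reach {s} {a} {y} old))
    ... | no no-new = inj₁ (s , n<1+n s , stable)
      where
      stable : StableAt s
      stable {x} (reach r) = reach (decidable-stable (T? _) λ ¬old → no-new (x , r , ¬old))

    stabilises : ∃[ j ] j ≤ k × StableAt j
    stabilises with stabilises-or-grows (suc k)
    ... | inj₁ (j , s≤s j≤k , st) = j , j≤k , st
    ... | inj₂ k<count = ⊥-elim (<⇒≱ k<count count≤k)
      where
      count≤k : reachCount (suc k) ≤ k
      count≤k = subst (reachCount (suc k) ≤_) (length-tabulate id) (countB≤length _ (allFin k))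

  reach-bounded : ∀ s {a b} → Reach s a b → Reach k a b
  reach-bounded s {a} r with stabilises a
  ... | j , j≤k , st = reach-mono (≤⇒≤′ j≤k) (stable-absorbs a st s r)

  sameComp-sym : ∀ {a b} → T (sameComp ok L a b) → T (sameComp ok L b a)
  sameComp-sym r = Reach.reached (reach-sym k (reach r))

  sameComp-trans : ∀ {a b c} → T (sameComp ok L a b) → T (sameComp ok L b c) → T (sameComp ok L a c)
  sameComp-trans r r′ = Reach.reached (reach-bounded (k + k) (reach-trans k k (reach r) (reach r′)))

  separated : Fin k → Fin k → Bool
  separated x y = ok x ∧ ok y ∧ not (sameComp ok L x y)

  separated-sym : Symmetric (λ x y → T (separated x y))
  separated-sym {x} {y} sep with ok x | ok y
  ... | true | true = ¬T⇒T-not (T-not⇒¬T sep ∘ sameComp-sym)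

  separated-split : ∀ {x y z} → T (separated x z) →
                    T (not (ok y)) ⊎ T (separated x y) ⊎ T (separated y z)
  separated-split {x} {y} {z} sep with ok x | ok y | ok z | T? (sameComp ok L x y) | T? (sameComp ok L y z)
  ... | true | false | true | _ | _ = inj₁ tt
  ... | true | true | true | no ¬xy | _ = inj₂ (inj₁ (¬T⇒T-not ¬xy))
  ... | true | true | true | yes xy | no ¬yz = inj₂ (inj₂ (¬T⇒T-not ¬yz))
  ... | true | true | true | yes xy | yes yz = ⊥-elim (T-not⇒¬T sep (sameComp-trans xy yz))

lower-view : ∀ {n} (u x : Fin (suc n)) → (x ≡ u × lower u x ≡ nothing) ⊎ ∃[ y ] punchIn u y ≡ x × lower u x ≡ just y
lower-view u x with u ≟ x
... | yes u≡x = inj₁ (sym u≡x , refl)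
... | no u≢x = inj₂ (punchOut u≢x , punchIn-punchOut u≢x , refl)

data EdgeAt {n} (u : Fin (suc n)) : Fin (suc n) × Fin (suc n) → Set where
  touching : ∀ {e} → incident u e ≡ true → lowerEdge u e ≡ nothing → EdgeAt u e
  avoiding : ∀ a b → incident u (punchIn u a , punchIn u b) ≡ false →
             lowerEdge u (punchIn u a , punchIn u b) ≡ just (a , b) → EdgeAt u (punchIn u a , punchIn u b)

lowerEdge-nothing : ∀ {n} {u a b : Fin (suc n)} → lower u a ≡ nothing ⊎ lower u b ≡ nothing →
                    lowerEdge u (a , b) ≡ nothing
lowerEdge-nothing (inj₁ la) rewrite la = refl
lowerEdge-nothing {u = u} {a} (inj₂ lb) rewrite lb with lower u a
... | just _ = refl
... | nothing = refl

lowerEdge-just : ∀ {n} {u a b : Fin (suc n)} {a′ b′} → lower u a ≡ just a′ → lower u b ≡ just b′ →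
                 lowerEdge u (a , b) ≡ just (a′ , b′)
lowerEdge-just la lb rewrite la | lb = refl

edgeAt : ∀ {n} (u : Fin (suc n)) e → EdgeAt u e
edgeAt u (a , b) with lower-view u a | lower-view u b
... | inj₁ (refl , la) | _ =
  touching (cong (_∨ (b == u)) (dec-true (u ≟ u) refl)) (lowerEdge-nothing (inj₁ la))
... | inj₂ (a′ , refl , la) | inj₁ (refl , lb) =
  touching (trans (cong ((punchIn u a′ == u) ∨_) (dec-true (u ≟ u) refl)) (∨-zeroʳ _)) (lowerEdge-nothing (inj₂ lb))
... | inj₂ (a′ , refl , la) | inj₂ (b′ , refl , lb) =
  avoiding a′ b′ (cong₂ _∨_ (avoids a′) (avoids b′)) (lowerEdge-just la lb)
  where
  avoids : ∀ x → punchIn u x == u ≡ false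
  avoids x = dec-false (punchIn u x ≟ u) (punchInᵢ≢i u x)

module _ {n} (u : Fin (suc n)) (R : Fin (suc n) → Fin (suc n) → Bool) where

  countB-split-at : ∀ E → countB (uncurry R) E ≡
                    countB (uncurry (R on punchIn u)) (mapMaybe (lowerEdge u) E) + countB (uncurry R) (incEdges u E)
  countB-split-at [] = refl
  countB-split-at (e ∷ E) with edgeAt u e
  ... | touching i l rewrite i | l = begin
    countB P (e ∷ E)                          ≡⟨ countB-∷ P e E ⟩
    indicator (P e) + countB P E              ≡⟨ cong (indicator (P e) +_) (countB-split-at E) ⟩
    indicator (P e) + (A + B)                 ≡⟨ x∙yz≈y∙xz (indicator (P e)) A B ⟩
    A + (indicator (P e) + B)                 ≡⟨ cong (A +_) (countB-∷ P e (incEdges u E)) ⟨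
    A + countB P (e ∷ incEdges u E)           ∎
    where
    open ≡-Reasoning
    P = uncurry R
    A = countB (uncurry (R on punchIn u)) (mapMaybe (lowerEdge u) E)
    B = countB P (incEdges u E)
  ... | avoiding a b i l rewrite i | l = begin
    countB P (e′ ∷ E)                         ≡⟨ countB-∷ P e′ E ⟩
    indicator (P e′) + countB P E             ≡⟨ cong (indicator (P e′) +_) (countB-split-at E) ⟩
    indicator (P e′) + (A + B)                ≡⟨ +-assoc (indicator (P e′)) A B ⟨
    indicator (P e′) + A + B                  ≡⟨ cong (_+ B) (countB-∷ (uncurry (R on punchIn u)) (a , b) (mapMaybe (lowerEdge u) E)) ⟨
    countB (uncurry (R on punchIn u)) ((a , b) ∷ mapMaybe (lowerEdge u) E) + B ∎
    where
    open ≡-Reasoning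
    P = uncurry R
    e′ = (punchIn u a , punchIn u b)
    A = countB (uncurry (R on punchIn u)) (mapMaybe (lowerEdge u) E)
    B = countB P (incEdges u E)

incident-other : ∀ {n} (u : Fin n) e → T (incident u e) → e ≡ (u , other u e) ⊎ e ≡ (other u e , u)
incident-other u (a , b) i with a ≟ u
... | yes refl = inj₁ refl
... | no _ = inj₂ (cong (a ,_) (==⇒≡ i))

incident-edge-to : ∀ {n} {u x : Fin n} {E} {R : Fin n → Fin n → Bool} → Symmetric (λ x y → T (R x y)) →
                   x ∈ map (other u) (incEdges u E) → T (R x u) → Any (T ∘ uncurry R) (incEdges u E)
incident-edge-to {u = u} {E = E} {R} R-sym x∈ r with ∈-map⁻ (other u) x∈
... | e , e∈ , refl with incident-other u e (proj₂ (∈-filter⁻ (T? ∘ incident u) {xs = E} e∈))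
... | inj₁ e≡ = lose e∈ (subst (T ∘ uncurry R) (sym e≡) (R-sym r))
... | inj₂ e≡ = lose e∈ (subst (T ∘ uncurry R) (sym e≡) r)

smooth-countB : ∀ {n} (E : Edges (suc n)) (u v w : Fin (suc n)) (uv : u ≢ v) (uw : u ≢ w) →
                map (other u) (incEdges u E) ≡ v ∷ w ∷ [] →
                ∀ {R} → Symmetric (λ x y → T (R x y)) → ∀ c → (T (R v w) → T c ⊎ T (R v u) ⊎ T (R u w)) →
                countB (uncurry (R on punchIn u)) (smooth E u v w uv uw) ≤ indicator c + countB (uncurry R) E
smooth-countB E u v w uv uw neighbours {R} R-sym c triangle = begin
  countB (uncurry (R on punchIn u)) (smooth E u v w uv uw)
    ≡⟨ countB-∷ (uncurry (R on punchIn u)) (punchOut uv , punchOut uw) (mapMaybe (lowerEdge u) E) ⟩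
  indicator (R (punchIn u (punchOut uv)) (punchIn u (punchOut uw))) + A
    ≡⟨ cong₂ (λ x y → indicator (R x y) + A) (punchIn-punchOut uv) (punchIn-punchOut uw) ⟩
  indicator (R v w) + A                ≤⟨ +-monoˡ-≤ A (indicator≤countB new-edge-covered) ⟩
  indicator c + B + A                  ≡⟨ +-assoc (indicator c) B A ⟩
  indicator c + (B + A)                ≡⟨ cong (indicator c +_) (+-comm B A) ⟩
  indicator c + (A + B)                ≡⟨ cong (indicator c +_) (countB-split-at u R E) ⟨
  indicator c + countB (uncurry R) E   ∎
  where
  open ≤-Reasoning
  A = countB (uncurry (R on punchIn u)) (mapMaybe (lowerEdge u) E)
  B = countB (uncurry R) (incEdges u E)
  v∈ : v ∈ map (other u) (incEdges u E)
  v∈ = subst (v ∈_) (sym neighbours) (here refl)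
  w∈ : w ∈ map (other u) (incEdges u E)
  w∈ = subst (w ∈_) (sym neighbours) (there (here refl))
  new-edge-covered : T (R v w) → T c ⊎ Any (T ∘ uncurry R) (incEdges u E)
  new-edge-covered = map₂ [ incident-edge-to {E = E} R-sym v∈ , (incident-edge-to {E = E} R-sym w∈ ∘ R-sym) ] ∘ triangle

maxL-map-mono : ∀ {A : Set} {f g : A → ℕ} → (∀ x → f x ≤ g x) → ∀ xs → maxL (map f xs) ≤ maxL (map g xs)
maxL-map-mono f≤g [] = z≤n
maxL-map-mono f≤g (x ∷ xs) = ⊔-mono-≤ (f≤g x) (maxL-map-mono f≤g xs)

deleteVertex : ∀ {n} → Fin (suc n) → TCD (suc n) → TCD n
deleteVertex u D = record { k = k ; links = links ; isTree = isTree ; bag = bag ∘ punchIn u }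
  where open TCD D

module _ {n} (E : Edges (suc n)) (u v w : Fin (suc n)) (uv : u ≢ v) (uw : u ≢ w)
         (neighbours : map (other u) (incEdges u E) ≡ v ∷ w ∷ []) (D : TCD (suc n)) where
  open TCD D
  open Reachability using (separated; separated-sym; separated-split)

  private
    E′ : Edges n
    E′ = smooth E u v w uv uw

    D′ : TCD n
    D′ = deleteVertex u D

  smooth-separated : ∀ (ok : Fin k → Bool) (L : Edges k) →
                     countB (uncurry ((separated ok L on bag) on punchIn u)) E′ ≤
                     indicator (not (ok (bag u))) + countB (uncurry (separated ok L on bag)) E
  smooth-separated ok L =
    smooth-countB E u v w uv uw neighbours (separated-sym ok L) (not (ok (bag u))) (separated-split ok L)

  -- adhLink and adhNode count exactly the separated edges, for ok = allV and for ok c = not (c == b).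
  adhLink-deleteVertex : ∀ l → adhLink E′ D′ l ≤ adhLink E D l
  adhLink-deleteVertex l = smooth-separated allV (removeAt links l)

  nodeLoad-deleteVertex : ∀ b → bagSize E′ D′ b + adhNode E′ D′ b ≤ bagSize E D b + adhNode E D b
  nodeLoad-deleteVertex b = begin
    bagSize E′ D′ b + adhNode E′ D′ b        ≤⟨ +-monoʳ-≤ (bagSize E′ D′ b) adhNode-≤ ⟩
    bagSize E′ D′ b + (i + adhNode E D b)    ≡⟨ x∙yz≈y∙xz (bagSize E′ D′ b) i (adhNode E D b) ⟩
    i + (bagSize E′ D′ b + adhNode E D b)    ≡⟨ +-assoc i (bagSize E′ D′ b) (adhNode E D b) ⟨
    i + bagSize E′ D′ b + adhNode E D b      ≡⟨ cong (_+ adhNode E D b) (countB-allFin-punchIn (λ x → bag x == b) u) ⟨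
    bagSize E D b + adhNode E D b            ∎
    where
    open ≤-Reasoning
    i = indicator (bag u == b)
    adhNode-≤ : adhNode E′ D′ b ≤ i + adhNode E D b
    adhNode-≤ = subst (λ c → adhNode E′ D′ b ≤ indicator c + adhNode E D b) (not-involutive (bag u == b))
                      (smooth-separated (λ c → not (c == b)) links)

  width-deleteVertex : width E′ D′ ≤ width E D
  width-deleteVertex = ⊔-mono-≤ (maxL-map-mono adhLink-deleteVertex (allFin (length links)))
                                (maxL-map-mono nodeLoad-deleteVertex (allFin k))

mainTheorem16 : (n : ℕ) (E : Edges (suc n)) → IsGraph E →
                (u v w : Fin (suc n)) (uv : u ≢ v) (uw : u ≢ w) → v ≢ w →
                map (other u) (incEdges u E) ≡ v ∷ w ∷ [] →
                (s s′ : ℕ) → IsScw E s → IsScw (smooth E u v w uv uw) s′ →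
                s′ ≤ s
mainTheorem16 n E _ u v w uv uw _ neighbours s s′ ((D , width≡s) , _) (_ , s′-minimal) = begin
  s′                                                    ≤⟨ s′-minimal (deleteVertex u D) ⟩
  width (smooth E u v w uv uw) (deleteVertex u D)       ≤⟨ width-deleteVertex E u v w uv uw neighbours D ⟩
  width E D                                             ≡⟨ width≡s ⟩
  s                                                     ∎
  where open ≤-Reasoning
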